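{- Let $T$ be a tree of order $n$ with diameter $D(T)\ge 4$, let $l(T)$ be the number of leaves of $T$, let $u$ be a leaf of $T$, and let $T'_u$ be the tree obtained from $T$ by removing all leaves except $u$. Then $$\beta(\mathring{T})+l(T)-1\le \operatorname{Sd}_s(T,T^c)\le \beta(T'_u)+l(T)-1.$$
   Context: All graphs are finite, simple and undirected; $T^c$ denotes the complement of $T$ on the same vertex set. $\mathring{T}$ denotes the subgraph of $T$ induced by its non-leaf vertices. $\beta(H)$ is the vertex cover number of $H$ (minimum size of a set of vertices incident with every edge). For a connected graph $H$, a vertex $w$ strongly resolves $x,y$ if $d_H(x,w)=d_H(x,y)+d_H(y,w)$ or $d_H(y,w)=d_H(y,x)+d_H(x,w)$, where $d_H$ is the shortest-path distance; a set $S\subseteq V(H)$ is a strong metric generator for $H$ if every two distinct vertices are strongly resolved by some vertex of $S$. For connected graphs $G_1,\dots,G_k$ on a common vertex set $V$, $\operatorname{Sd}_s(G_1,\dots,G_k)$ is the minimum cardinality of a set $S\subseteq V$ that is a strong metric generator for every $G_i$. -}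

module Defs where

open import Data.Nat using (ℕ; zero; suc; _+_; _≤_; _∸_)
open import Data.Nat as ℕ using (_≡ᵇ_)
open import Data.Bool using (Bool; true; false; not; _∧_; _∨_)
open import Data.Fin using (Fin)
open import Data.Fin.Properties using (_≟_)
open import Data.Fin.Subset using (Subset; _∈_; _∉_; _⊆_; ∣_∣; ⁅_⁆; _∪_)
open import Data.Vec using (Vec; tabulate)
open import Data.List using (List; []; _∷_; length)
open import Data.List.Relation.Unary.Unique.Propositional using (Unique)
open import Data.Product using (Σ; ∃; ∃-syntax; _×_; _,_)
open import Data.Sum using (_⊎_)
open import Relation.Binary.PropositionalEquality using (_≡_; _≢_)
open import Relation.Nullary using (¬_)
open import Relation.Nullary.Decidable using (⌊_⌋)

record Graph (n : ℕ) : Set where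
  field
    E     : Fin n → Fin n → Bool
    E-sym : ∀ x y → E x y ≡ E y x
    E-irrefl : ∀ x → E x x ≡ false
open Graph public

complement : ∀ {n} → Graph n → Graph n
complement {n} G = record
  { E = λ x y → not (E G x y) ∧ not ⌊ x ≟ y ⌋
  ; E-sym = symC
  ; E-irrefl = irC }
  where
  open import Relation.Binary.PropositionalEquality using (refl; cong₂; sym)
  open import Relation.Nullary using (yes; no)
  eqsym : ∀ (x y : Fin n) → ⌊ x ≟ y ⌋ ≡ ⌊ y ≟ x ⌋
  eqsym x y with x ≟ y | y ≟ x
  ... | yes _ | yes _ = refl
  ... | yes p | no q = Data.Empty.⊥-elim (q (sym p)) where import Data.Empty
  ... | no p | yes q = Data.Empty.⊥-elim (p (sym q)) where import Data.Empty
  ... | no _ | no _ = refl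
  symC : ∀ x y → (not (E G x y) ∧ not ⌊ x ≟ y ⌋) ≡ (not (E G y x) ∧ not ⌊ y ≟ x ⌋)
  symC x y = cong₂ (λ a b → not a ∧ not b) (E-sym G x y) (eqsym x y)
  irC : ∀ x → (not (E G x x) ∧ not ⌊ x ≟ x ⌋) ≡ false
  irC x with x ≟ x
  ... | yes _ = Data.Bool.Properties.∧-zeroʳ (not (E G x x)) where import Data.Bool.Properties
  ... | no ¬p = Data.Empty.⊥-elim (¬p refl) where import Data.Empty

Adj : ∀ {n} → Graph n → Fin n → Fin n → Set
Adj G x y = E G x y ≡ true

data Walk {n} (G : Graph n) : Fin n → Fin n → ℕ → Set where
  here : ∀ {x} → Walk G x x zero
  step : ∀ {x y z k} → Adj G x y → Walk G y z k → Walk G x z (suc k)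

Connected : ∀ {n} → Graph n → Set
Connected G = ∀ x y → ∃[ k ] Walk G x y k

Dist : ∀ {n} → Graph n → Fin n → Fin n → ℕ → Set
Dist G x y k = Walk G x y k × (∀ m → Walk G x y m → k ≤ m)

data Path {n} (G : Graph n) : Fin n → List (Fin n) → Fin n → Set where
  end  : ∀ {x} → Path G x (x ∷ []) x
  cons : ∀ {x y vs z} → Adj G x y → Path G y vs z → Path G x (x ∷ vs) z

HasCycle : ∀ {n} → Graph n → Set
HasCycle G = ∃[ x ] ∃[ vs ] ∃[ z ]
  (Path G x vs z × Unique vs × 3 ≤ length vs × Adj G z x)

IsTree : ∀ {n} → Graph n → Set
IsTree G = Connected G × ¬ HasCycle G

DiameterAtLeast : ∀ {n} → Graph n → ℕ → Set
DiameterAtLeast G d = ∃[ x ] ∃[ y ] ∃[ k ] (Dist G x y k × d ≤ k)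

neighbourhood : ∀ {n} → Graph n → Fin n → Subset n
neighbourhood G x = tabulate (E G x)

degree : ∀ {n} → Graph n → Fin n → ℕ
degree G x = ∣ neighbourhood G x ∣

IsLeaf : ∀ {n} → Graph n → Fin n → Set
IsLeaf G x = degree G x ≡ 1

leaves : ∀ {n} → Graph n → Subset n
leaves G = tabulate (λ x → degree G x ≡ᵇ 1)

numLeaves : ∀ {n} → Graph n → ℕ
numLeaves G = ∣ leaves G ∣

-- Vertex set of T̊ (non-leaves) and of T'_u (non-leaves together with u).
nonLeaves : ∀ {n} → Graph n → Subset n
nonLeaves G = tabulate (λ x → not (degree G x ≡ᵇ 1))

prunedExcept : ∀ {n} → Graph n → Fin n → Subset n
prunedExcept G u = nonLeaves G ∪ ⁅ u ⁆

IsVertexCoverInduced : ∀ {n} → Graph n → Subset n → Subset n → Set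
IsVertexCoverInduced G W S =
  S ⊆ W × (∀ x y → x ∈ W → y ∈ W → Adj G x y → x ∈ S ⊎ y ∈ S)

IsMinimum : ∀ {n} → (Subset n → Set) → ℕ → Set
IsMinimum P k = (∃[ S ] (P S × ∣ S ∣ ≡ k)) × (∀ S → P S → k ≤ ∣ S ∣)

VertexCoverNumberInduced : ∀ {n} → Graph n → Subset n → ℕ → Set
VertexCoverNumberInduced G W k = IsMinimum (IsVertexCoverInduced G W) k

StronglyResolves : ∀ {n} → Graph n → Fin n → Fin n → Fin n → Set
StronglyResolves G w x y =
  ∃[ dxw ] ∃[ dxy ] ∃[ dyw ]
    (Dist G x w dxw × Dist G x y dxy × Dist G y w dyw ×
      (dxw ≡ dxy + dyw ⊎ dyw ≡ dxy + dxw))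

IsStrongMetricGenerator : ∀ {n} → Graph n → Subset n → Set
IsStrongMetricGenerator G S =
  ∀ x y → x ≢ y → ∃[ w ] (w ∈ S × StronglyResolves G w x y)

SimultaneousStrongMetricDim₂ : ∀ {n} → Graph n → Graph n → ℕ → Set
SimultaneousStrongMetricDim₂ G₁ G₂ k =
  IsMinimum (λ S → IsStrongMetricGenerator G₁ S × IsStrongMetricGenerator G₂ S) k

-- Once diam T ≥ 4, the complement has diameter 2 and two T-adjacent vertices are
-- at distance 2 in it, so only they themselves strongly resolve them: a simultaneous generator S
-- covers every edge of T, and S ∩ V(T̊) covers T̊.  In T a leaf never lies inside a geodesic, so
-- two leaves are strongly resolved only by themselves and S misses at most one leaf.
--
-- For a vertex cover C of T'ᵤ take S = C ∪ (leaves − u).  In T every geodesic from x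
-- through y extends to a leaf, and the extensions beyond y and beyond x cannot both end at u.  In
-- the complement, a vertex outside S has all its T-neighbours in S, and a T-neighbour a of x that
-- is not a T-neighbour of y resolves x, y since d(x,a) = 2 = d(x,y) + d(y,a); in a tree such an a
-- exists for x or for y unless both are leaves outside S, i.e. both equal u.

module Submission where

open import Defs
open import Data.Nat using (ℕ; zero; suc; _+_; _∸_; _≤_; _<_; z≤n; s≤s; _≡ᵇ_) renaming (_≟_ to _≟ℕ_)
open import Data.Nat.Properties hiding (_≟_)
open import Data.Bool using (Bool; true; false; not)
open import Data.Bool.Properties using (T-≡) renaming (_≟_ to _≟ᵇ_)
open import Data.Fin using (Fin)
open import Data.Fin.Properties using (_≟_; any?)
open import Data.Fin.Subset using (Subset; _∈_; _∉_; _⊆_; ∣_∣; ⁅_⁆; _∪_; _∩_; ∁; _-_)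
open import Data.Fin.Subset.Properties
  using (_∈?_; nonempty?; Empty-unique; ∣⊥∣≡0; ∣⁅x⁆∣≡1; p⊆q⇒∣p∣≤∣q∣; x∈⁅x⁆; x∈⁅y⁆⇒x≡y;
         x∈p∧x≢y⇒x∈p-y; x∈p⇒∣p-x∣<∣p∣; x∈p∩q⁺; x∈p∩q⁻; p∩q⊆q; x∈p∪q⁺; x∉p⇒x∈∁p; x∈∁p⇒x∉p)
open import Data.Vec using (_∷_; []; tabulate)
open import Data.Vec.Properties using (lookup∘tabulate; tabulate-∘; []=⇒lookup; lookup⇒[]=)
open import Data.List using (List; []; _∷_; length; filter; allFin)
open import Data.List.Extrema.Nat using (argmax; argmax-all; f[xs]≤f[argmax])
open import Data.List.Membership.Propositional using () renaming (_∈_ to _∈ˡ_; _∉_ to _∉ˡ_)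
open import Data.List.Membership.Propositional.Properties using (∈-++⁻; ∈-filter⁺; ∈-allFin)
open import Data.List.Relation.Binary.Subset.Propositional using () renaming (_⊆_ to _⊆ˡ_)
open import Data.List.Relation.Unary.Any using (here; there)
import Data.List.Relation.Unary.All as All
open import Data.List.Relation.Unary.All.Properties using (all-filter)
open import Data.List.Relation.Unary.AllPairs using ([]; _∷_)
open import Data.List.Relation.Unary.Unique.Propositional using (Unique)
open import Data.Product using (∃; ∃-syntax; _×_; _,_; proj₁; proj₂)
open import Data.Sum as Sum using (_⊎_; inj₁; inj₂; swap)
open import Data.Empty using (⊥; ⊥-elim)
open import Function using (_∘_; id)
open import Function.Bundles using (Equivalence)
open import Relation.Binary.PropositionalEquality
open import Relation.Nullary using (¬_; yes; no; Dec)
open import Relation.Nullary.Decidable using (_×-dec_; ¬?)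

private
  variable
    n : ℕ

m+n≤m⇒n≡0 : ∀ m {n} → m + n ≤ m → n ≡ 0
m+n≤m⇒n≡0 m {n} m+n≤m = n≤0⇒n≡0 (+-cancelˡ-≤ m n 0 (subst (m + n ≤_) (sym (+-identityʳ m)) m+n≤m))

minimal-witness : (P : ℕ → Set) → (∀ m → Dec (P m)) → ∀ {k} → P k →
  ∃[ m ] P m × (∀ m′ → P m′ → m ≤ m′)
minimal-witness P P? {k} pk = Sum.[ (λ k<all → ⊥-elim (1+n≰n (k<all k pk))) , id ]′ (search (suc k))
  where
  search : ∀ i → (∀ j → P j → i ≤ j) ⊎ (∃[ m ] P m × (∀ m′ → P m′ → m ≤ m′))
  search zero = inj₁ (λ _ _ → z≤n)
  search (suc i) with search i
  ... | inj₂ found = inj₂ found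
  ... | inj₁ i≤ with P? i
  ...   | yes pi = inj₂ (i , pi , i≤)
  ...   | no ¬pi = inj₁ (λ j pj → ≤∧≢⇒< (i≤ j pj) (λ { refl → ¬pi pj }))

maximum-exists : {P : Fin n → Set} → (∀ v → Dec (P v)) → (f : Fin n → ℕ) → ∀ {y} → P y →
  ∃[ w ] P w × (∀ {v} → P v → f v ≤ f w)
maximum-exists {n} P? f {y} py =
  argmax f y candidates ,
  argmax-all f py (all-filter P? (allFin n)) ,
  λ {v} pv → All.lookup (f[xs]≤f[argmax] y candidates) (∈-filter⁺ P? (∈-allFin v) pv)
  where
  candidates : List (Fin n)
  candidates = filter P? (allFin n)

∣p∣≡∣p∩q∣+∣p∩∁q∣ : (p q : Subset n) → ∣ p ∣ ≡ ∣ p ∩ q ∣ + ∣ p ∩ ∁ q ∣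
∣p∣≡∣p∩q∣+∣p∩∁q∣ []          []          = refl
∣p∣≡∣p∩q∣+∣p∩∁q∣ (true  ∷ p) (true  ∷ q) = cong suc (∣p∣≡∣p∩q∣+∣p∩∁q∣ p q)
∣p∣≡∣p∩q∣+∣p∩∁q∣ (true  ∷ p) (false ∷ q) =
  trans (cong suc (∣p∣≡∣p∩q∣+∣p∩∁q∣ p q)) (sym (+-suc _ _))
∣p∣≡∣p∩q∣+∣p∩∁q∣ (false ∷ p) (_     ∷ q) = ∣p∣≡∣p∩q∣+∣p∩∁q∣ p q

∣p∪q∣≤∣p∣+∣q∣ : (p q : Subset n) → ∣ p ∪ q ∣ ≤ ∣ p ∣ + ∣ q ∣
∣p∪q∣≤∣p∣+∣q∣ []          []          = z≤n
∣p∪q∣≤∣p∣+∣q∣ (true  ∷ p) (true  ∷ q) =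
  s≤s (≤-trans (∣p∪q∣≤∣p∣+∣q∣ p q) (+-monoʳ-≤ ∣ p ∣ (n≤1+n ∣ q ∣)))
∣p∪q∣≤∣p∣+∣q∣ (true  ∷ p) (false ∷ q) = s≤s (∣p∪q∣≤∣p∣+∣q∣ p q)
∣p∪q∣≤∣p∣+∣q∣ (false ∷ p) (true  ∷ q) =
  ≤-trans (s≤s (∣p∪q∣≤∣p∣+∣q∣ p q)) (≤-reflexive (sym (+-suc ∣ p ∣ ∣ q ∣)))
∣p∪q∣≤∣p∣+∣q∣ (false ∷ p) (false ∷ q) = ∣p∪q∣≤∣p∣+∣q∣ p q

x∈p⇒0<∣p∣ : {p : Subset n} {x : Fin n} → x ∈ p → 0 < ∣ p ∣
x∈p⇒0<∣p∣ {p = p} {x} x∈p = subst (_≤ ∣ p ∣) (∣⁅x⁆∣≡1 x) (p⊆q⇒∣p∣≤∣q∣ ⁅x⁆⊆p)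
  where
  ⁅x⁆⊆p : ⁅ x ⁆ ⊆ p
  ⁅x⁆⊆p y∈⁅x⁆ = subst (_∈ p) (sym (x∈⁅y⁆⇒x≡y x y∈⁅x⁆)) x∈p

∣p∣≤1 : (p : Subset n) → (∀ {x y} → x ∈ p → y ∈ p → x ≡ y) → ∣ p ∣ ≤ 1
∣p∣≤1 {n} p unique with nonempty? p
... | yes (x , x∈p) = ≤-trans (p⊆q⇒∣p∣≤∣q∣ p⊆⁅x⁆) (≤-reflexive (∣⁅x⁆∣≡1 x))
  where
  p⊆⁅x⁆ : p ⊆ ⁅ x ⁆
  p⊆⁅x⁆ y∈p = subst (_∈ ⁅ x ⁆) (unique x∈p y∈p) (x∈⁅x⁆ x)
... | no empty = ≤-trans (≤-reflexive (trans (cong ∣_∣ (Empty-unique empty)) (∣⊥∣≡0 n))) z≤n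

∣p∣≡1 : {p : Subset n} {x : Fin n} → x ∈ p → (∀ {y} → y ∈ p → y ≡ x) → ∣ p ∣ ≡ 1
∣p∣≡1 {p = p} x∈p onlyX =
  ≤-antisym (∣p∣≤1 p (λ y∈p z∈p → trans (onlyX y∈p) (sym (onlyX z∈p)))) (x∈p⇒0<∣p∣ x∈p)

∣p∣≡1⇒x≡y : {p : Subset n} {x y : Fin n} → ∣ p ∣ ≡ 1 → x ∈ p → y ∈ p → x ≡ y
∣p∣≡1⇒x≡y {p = p} {x} {y} ∣p∣≡1 x∈p y∈p with x ≟ y
... | yes x≡y = x≡y
... | no x≢y  = ⊥-elim (<⇒≱ ∣p-y∣<1 (x∈p⇒0<∣p∣ (x∈p∧x≢y⇒x∈p-y x∈p x≢y)))
  where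
  ∣p-y∣<1 : ∣ p - y ∣ < 1
  ∣p-y∣<1 = subst (∣ p - y ∣ <_) ∣p∣≡1 (x∈p⇒∣p-x∣<∣p∣ y∈p)

∈-tabulate⁺ : {f : Fin n → Bool} {x : Fin n} → f x ≡ true → x ∈ tabulate f
∈-tabulate⁺ {f = f} {x} fx = lookup⇒[]= x (tabulate f) (trans (lookup∘tabulate f x) fx)

∈-tabulate⁻ : {f : Fin n → Bool} {x : Fin n} → x ∈ tabulate f → f x ≡ true
∈-tabulate⁻ {f = f} {x} x∈ = trans (sym (lookup∘tabulate f x)) ([]=⇒lookup x∈)

DiameterAtMost : Graph n → ℕ → Set
DiameterAtMost G d = ∀ x y → ∃[ k ] k ≤ d × Dist G x y k

nonLeaves≡∁leaves : (G : Graph n) → nonLeaves G ≡ ∁ (leaves G)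
nonLeaves≡∁leaves G = tabulate-∘ not (λ x → degree G x ≡ᵇ 1)

module GraphProperties (G : Graph n) where
  open import Data.List.Membership.DecPropositional (_≟_ {n}) using () renaming (_∈?_ to _∈ˡ?_)

  Adj-sym : ∀ {x y} → Adj G x y → Adj G y x
  Adj-sym {x} {y} xy = trans (E-sym G y x) xy

  Adj⇒≢ : ∀ {x y} → Adj G x y → x ≢ y
  Adj⇒≢ {x} xx refl with () ← trans (sym xx) (E-irrefl G x)

  IsLeaf⇒∈leaves : ∀ {x} → IsLeaf G x → x ∈ leaves G
  IsLeaf⇒∈leaves deg≡1 = ∈-tabulate⁺ (Equivalence.to T-≡ (≡⇒≡ᵇ _ _ deg≡1))

  ∈leaves⇒IsLeaf : ∀ {x} → x ∈ leaves G → IsLeaf G x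
  ∈leaves⇒IsLeaf x∈ = ≡ᵇ⇒≡ _ _ (Equivalence.from T-≡ (∈-tabulate⁻ x∈))

  leaf-neighbour-unique : ∀ {x y z} → IsLeaf G x → Adj G x y → Adj G x z → y ≡ z
  leaf-neighbour-unique leaf xy xz = ∣p∣≡1⇒x≡y leaf (∈-tabulate⁺ xy) (∈-tabulate⁺ xz)

  unique-neighbour⇒IsLeaf : ∀ {x y} → Adj G x y → (∀ {z} → Adj G x z → z ≡ y) → IsLeaf G x
  unique-neighbour⇒IsLeaf xy onlyY = ∣p∣≡1 (∈-tabulate⁺ xy) (λ z∈ → onlyY (∈-tabulate⁻ z∈))

  infixr 5 _++ʷ_

  _++ʷ_ : ∀ {x y z k m} → Walk G x y k → Walk G y z m → Walk G x z (k + m)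
  here       ++ʷ ω = ω
  step xy υ ++ʷ ω = step xy (υ ++ʷ ω)

  reverseʷ : ∀ {x y k} → Walk G x y k → Walk G y x k
  reverseʷ here = here
  reverseʷ {k = suc k} (step xy ω) =
    subst (Walk G _ _) (+-comm k 1) (reverseʷ ω ++ʷ step (Adj-sym xy) here)

  Walk-length-0⇒≡ : ∀ {x y} → Walk G x y 0 → x ≡ y
  Walk-length-0⇒≡ here = refl

  walk? : ∀ x y k → Dec (Walk G x y k)
  walk? x y zero with x ≟ y
  ... | yes refl = yes here
  ... | no x≢y   = no (λ ω → x≢y (Walk-length-0⇒≡ ω))
  walk? x y (suc k) with any? (λ z → (E G x z ≟ᵇ true) ×-dec walk? z y k)
  ... | yes (z , xz , ω) = yes (step xz ω)
  ... | no ∄z            = no λ { (step xz ω) → ∄z (_ , xz , ω) }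

  Dist-unique : ∀ {x y k m} → Dist G x y k → Dist G x y m → k ≡ m
  Dist-unique (ω , min) (υ , min′) = ≤-antisym (min _ υ) (min′ _ ω)

  Dist-sym : ∀ {x y k} → Dist G x y k → Dist G y x k
  Dist-sym (ω , min) = reverseʷ ω , λ m υ → min m (reverseʷ υ)

  Dist-refl : ∀ {x} → Dist G x x 0
  Dist-refl = here , λ _ _ → z≤n

  vertices : ∀ {x y k} → Walk G x y k → List (Fin n)
  vertices {x} here        = x ∷ []
  vertices {x} (step _ ω) = x ∷ vertices ω

  ∈-vertices⇒split : ∀ {x y v k} (ω : Walk G x y k) → v ∈ˡ vertices ω →
    ∃[ i ] ∃[ j ] Walk G x v i × Walk G v y j × i + j ≡ k
  ∈-vertices⇒split here         (here refl) = 0 , 0 , here , here , refl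
  ∈-vertices⇒split (step xz ω) (here refl) = 0 , _ , here , step xz ω , refl
  ∈-vertices⇒split (step xz ω) (there v∈ω) with ∈-vertices⇒split ω v∈ω
  ... | i , j , zv , vy , i+j≡k = suc i , j , step xz zv , vy , cong suc i+j≡k

  ∈-vertices-++⁻ : ∀ {x y z v k m} (ω : Walk G x y k) (υ : Walk G y z m) →
    v ∈ˡ vertices (ω ++ʷ υ) → v ∈ˡ vertices ω ⊎ v ∈ˡ vertices υ
  ∈-vertices-++⁻ here        υ v∈          = inj₂ v∈
  ∈-vertices-++⁻ (step _ ω) υ (here refl)  = inj₁ (here refl)
  ∈-vertices-++⁻ (step _ ω) υ (there v∈) with ∈-vertices-++⁻ ω υ v∈
  ... | inj₁ v∈ω = inj₁ (there v∈ω)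
  ... | inj₂ v∈υ = inj₂ v∈υ

  SimplePath : Fin n → Fin n → List (Fin n) → Set
  SimplePath x y vs = Path G x vs y × Unique vs

  SimplePath-≢⇒2≤length : ∀ {x y vs} → SimplePath x y vs → x ≢ y → 2 ≤ length vs
  SimplePath-≢⇒2≤length (end , _)                x≢x = ⊥-elim (x≢x refl)
  SimplePath-≢⇒2≤length (cons _ end , _)         _   = s≤s (s≤s z≤n)
  SimplePath-≢⇒2≤length (cons _ (cons _ _) , _) _   = s≤s (s≤s z≤n)

  SimplePath-suffix : ∀ {x y z vs} → SimplePath x z vs → y ∈ˡ vs →
    ∃[ ws ] SimplePath y z ws × ws ⊆ˡ vs
  SimplePath-suffix π@(end , _)      (here refl) = _ , π , λ v∈ → v∈
  SimplePath-suffix π@(cons _ _ , _) (here refl) = _ , π , λ v∈ → v∈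
  SimplePath-suffix (cons _ π , _ ∷ unique) (there y∈) with SimplePath-suffix (π , unique) y∈
  ... | ws , π′ , ws⊆ = ws , π′ , λ v∈ → there (ws⊆ v∈)

  walk⇒SimplePath : ∀ {x y k} (ω : Walk G x y k) → ∃[ vs ] SimplePath x y vs × vs ⊆ˡ vertices ω
  walk⇒SimplePath here = _ , (end , All.[] ∷ []) , λ v∈ → v∈
  walk⇒SimplePath {x} (step xz ω) with walk⇒SimplePath ω
  ... | vs , π@(path , unique) , vs⊆ with x ∈ˡ? vs
  ...   | yes x∈vs = let ws , π′ , ws⊆ = SimplePath-suffix π x∈vs
                     in ws , π′ , λ v∈ → there (vs⊆ (ws⊆ v∈))
  ...   | no x∉vs  = x ∷ vs , (cons xz path , All.tabulate (λ { v∈ refl → x∉vs v∈ }) ∷ unique) ,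
                     λ { (here refl) → here refl ; (there v∈) → there (vs⊆ v∈) }

  avoiding-walk⇒HasCycle : ∀ {w x y k} → Adj G w x → Adj G y w → x ≢ y →
    (ω : Walk G x y k) → w ∉ˡ vertices ω → HasCycle G
  avoiding-walk⇒HasCycle {w} wx yw x≢y ω w∉ω with walk⇒SimplePath ω
  ... | vs , π@(path , unique) , vs⊆ =
    w , w ∷ vs , _ , cons wx path , All.tabulate (λ { v∈ refl → w∉ω (vs⊆ v∈) }) ∷ unique ,
    s≤s (SimplePath-≢⇒2≤length π x≢y) , yw

  Dist-length-0⇒≡ : ∀ {x y} → Dist G x y 0 → x ≡ y
  Dist-length-0⇒≡ (ω , _) = Walk-length-0⇒≡ ω

  self-strongly-resolves : ∀ {x y k} → Dist G x y k → StronglyResolves G x x y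
  self-strongly-resolves {k = k} xy =
    0 , k , k , Dist-refl , xy , Dist-sym xy , inj₂ (sym (+-identityʳ k))

  StronglyResolves-sym : ∀ {w x y} → StronglyResolves G w x y → StronglyResolves G w y x
  StronglyResolves-sym (dxw , dxy , dyw , xw , xy , yw , eq) =
    dyw , dxy , dxw , yw , Dist-sym xy , xw , swap eq

  leaf-shortcut : ∀ {x y z k i j} → Dist G x z k → Walk G x y i → Walk G y z j →
    IsLeaf G y → y ≢ x → y ≢ z → k < i + j
  -- Both walks leave y through its only neighbour, so the detour through y can be cut.
  leaf-shortcut {x} {y} {z} {k} (_ , minimal) xy yz leaf y≢x y≢z = shortcut (reverseʷ xy) yz
    where
    shortcut : ∀ {i j} → Walk G y x i → Walk G y z j → k < i + j
    shortcut here _ = ⊥-elim (y≢x refl)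
    shortcut (step _ _) here = ⊥-elim (y≢z refl)
    shortcut {suc i} {suc j} (step ya ax) (step yb bz) with leaf-neighbour-unique leaf ya yb
    ... | refl = s≤s (≤-trans (minimal _ (reverseʷ ax ++ʷ bz)) (+-monoʳ-≤ i (n≤1+n j)))

  leaves-strongly-resolved-only-by-themselves : ∀ {w x y} → IsLeaf G x → IsLeaf G y → x ≢ y →
    StronglyResolves G w x y → w ≡ x ⊎ w ≡ y
  leaves-strongly-resolved-only-by-themselves {w} {x} {y} leafx leafy x≢y
    (_ , _ , _ , xw , xy , yw , eq)
    with w ≟ x | w ≟ y
  ... | yes w≡x | _        = inj₁ w≡x
  ... | no _    | yes w≡y  = inj₂ w≡y
  ... | no w≢x  | no w≢y with eq
  ...   | inj₁ dxw≡ =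
    ⊥-elim (<⇒≢ (leaf-shortcut xw (proj₁ xy) (proj₁ yw) leafy (≢-sym x≢y) (≢-sym w≢y)) dxw≡)
  ...   | inj₂ dyw≡ =
    ⊥-elim (<⇒≢ (leaf-shortcut yw (reverseʷ (proj₁ xy)) (proj₁ xw) leafx x≢y (≢-sym w≢x)) dyw≡)

  DiameterAtMost⇒Dist≤ : ∀ {d x y k} → DiameterAtMost G d → Dist G x y k → k ≤ d
  DiameterAtMost⇒Dist≤ {x = x} {y} diam xy =
    let _ , k≤d , xy′ = diam x y in subst (_≤ _) (Dist-unique xy′ xy) k≤d

  pair-at-distance-2-resolved-only-by-itself : ∀ {w x y} → DiameterAtMost G 2 → Dist G x y 2 →
    StronglyResolves G w x y → w ≡ x ⊎ w ≡ y
  pair-at-distance-2-resolved-only-by-itself {w} {x} {y} diam xy (_ , _ , _ , xw , xy′ , yw , eq)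
    with Dist-unique xy′ xy
  ... | refl = swap (Sum.map (sym ∘ ends-at xw yw) (sym ∘ ends-at yw xw) eq)
    where
    ends-at : ∀ {a b c d e} → Dist G c b d → Dist G a b e → d ≡ 2 + e → a ≡ b
    ends-at cb ab d≡2+e = Dist-length-0⇒≡ (subst (Dist G _ _)
      (m+n≤m⇒n≡0 2 (subst (_≤ 2) d≡2+e (DiameterAtMost⇒Dist≤ diam cb))) ab)

  WithinOne : Fin n → Fin n → Set
  WithinOne z x = ∃[ m ] m ≤ 1 × Walk G z x m

  no-dominating-edge : ∀ {x y} → DiameterAtLeast G 4 → Adj G x y →
    ¬ (∀ z → WithinOne z x ⊎ WithinOne z y)
  no-dominating-edge {x} {y} diam≥4 xy near =
    let a , b , _ , (_ , minimal) , 4≤k = diam≥4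
        m , m≤3 , ab = walk≤3 (near a) (near b)
    in <⇒≱ (≤-trans 4≤k (minimal m ab)) m≤3
    where
    walk≤3 : ∀ {a b} → WithinOne a x ⊎ WithinOne a y → WithinOne b x ⊎ WithinOne b y →
      ∃[ m ] m ≤ 3 × Walk G a b m
    walk≤3 (inj₁ (_ , i≤1 , ax)) (inj₁ (_ , j≤1 , bx)) =
      _ , +-mono-≤ i≤1 (m≤n⇒m≤1+n j≤1) , ax ++ʷ reverseʷ bx
    walk≤3 (inj₁ (_ , i≤1 , ax)) (inj₂ (_ , j≤1 , by)) =
      _ , +-mono-≤ i≤1 (s≤s j≤1) , ax ++ʷ step xy (reverseʷ by)
    walk≤3 (inj₂ (_ , i≤1 , ay)) (inj₁ (_ , j≤1 , bx)) =
      _ , +-mono-≤ i≤1 (s≤s j≤1) , ay ++ʷ step (Adj-sym xy) (reverseʷ bx)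
    walk≤3 (inj₂ (_ , i≤1 , ay)) (inj₂ (_ , j≤1 , by)) =
      _ , +-mono-≤ i≤1 (m≤n⇒m≤1+n j≤1) , ay ++ʷ reverseʷ by

  common-non-neighbour : ∀ {x y} → DiameterAtLeast G 4 → Adj G x y →
    ∃[ z ] z ≢ x × z ≢ y × E G x z ≡ false × E G y z ≡ false
  common-non-neighbour {x} {y} diam≥4 xy
    with any? (λ z → ¬? (z ≟ x) ×-dec ¬? (z ≟ y) ×-dec (E G x z ≟ᵇ false) ×-dec (E G y z ≟ᵇ false))
  ... | yes found = found
  ... | no none = ⊥-elim (no-dominating-edge diam≥4 xy near)
    where
    near : ∀ z → WithinOne z x ⊎ WithinOne z y
    near z with z ≟ x | z ≟ y
    ... | yes refl | _        = inj₁ (0 , z≤n , here)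
    ... | no _     | yes refl = inj₂ (0 , z≤n , here)
    ... | no z≢x   | no z≢y with E G x z in xz | E G y z in yz
    ...   | true  | _     = inj₁ (1 , ≤-refl , step (Adj-sym xz) here)
    ...   | false | true  = inj₂ (1 , ≤-refl , step (Adj-sym yz) here)
    ...   | false | false = ⊥-elim (none (z , z≢x , z≢y , xz , yz))

module Distance {G : Graph n} (connected : Connected G) where

  open GraphProperties G

  shortest : ∀ x y → ∃ (Dist G x y)
  shortest x y = minimal-witness (Walk G x y) (walk? x y) (proj₂ (connected x y))

  dist : Fin n → Fin n → ℕ
  dist x y = proj₁ (shortest x y)

  dist-Dist : ∀ x y → Dist G x y (dist x y)
  dist-Dist x y = proj₂ (shortest x y)

  geodesic : ∀ x y → Walk G x y (dist x y)
  geodesic x y = proj₁ (dist-Dist x y)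

  dist≤ : ∀ {x y k} → Walk G x y k → dist x y ≤ k
  dist≤ {x} {y} ω = proj₂ (dist-Dist x y) _ ω

  dist-sym : ∀ x y → dist x y ≡ dist y x
  dist-sym x y = Dist-unique (dist-Dist x y) (Dist-sym (dist-Dist y x))

  dist-refl : ∀ x → dist x x ≡ 0
  dist-refl x = n≤0⇒n≡0 (dist≤ here)

  dist-triangle : ∀ x y z → dist x z ≤ dist x y + dist y z
  dist-triangle x y z = dist≤ (geodesic x y ++ʷ geodesic y z)

  dist-step : ∀ {x y z} → Adj G y z → dist x z ≤ dist x y + 1
  dist-step {x} {y} yz = dist≤ (geodesic x y ++ʷ step yz here)

  dist-pos : ∀ {x y} → x ≢ y → 0 < dist x y
  dist-pos {x} {y} x≢y with dist x y | dist-Dist x y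
  ... | zero  | xy = ⊥-elim (x≢y (Dist-length-0⇒≡ xy))
  ... | suc _ | _  = s≤s z≤n

  strongly-resolves : ∀ {w x y} → dist x w ≡ dist x y + dist y w ⊎ dist y w ≡ dist x y + dist x w →
    StronglyResolves G w x y
  strongly-resolves {w} {x} {y} eq = _ , _ , _ , dist-Dist x w , dist-Dist x y , dist-Dist y w , eq

  neighbour-exists : ∀ {x y} → x ≢ y → ∃[ z ] Adj G x z
  neighbour-exists {x} {y} x≢y with connected x y
  ... | _ , here       = ⊥-elim (x≢y refl)
  ... | _ , step xz _ = _ , xz

  far-from-start⇒end : ∀ {x y v k} (ω : Walk G x y k) → v ∈ˡ vertices ω → k ≤ dist x v → v ≡ y
  far-from-start⇒end ω v∈ω k≤ with ∈-vertices⇒split ω v∈ω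
  ... | i , j , xv , vy , refl =
    Walk-length-0⇒≡ (subst (Walk G _ _) (m+n≤m⇒n≡0 i (≤-trans k≤ (dist≤ xv))) vy)

  far-from-end⇒start : ∀ {x y v k} (ω : Walk G x y k) → v ∈ˡ vertices ω → k ≤ dist v y → v ≡ x
  far-from-end⇒start ω v∈ω k≤ with ∈-vertices⇒split ω v∈ω
  ... | i , j , xv , vy , refl = sym (Walk-length-0⇒≡ (subst (Walk G _ _) i≡0 xv))
    where
    i≡0 : i ≡ 0
    i≡0 = m+n≤m⇒n≡0 j (subst (_≤ j) (+-comm _ j) (≤-trans k≤ (dist≤ vy)))

  Between : Fin n → Fin n → Fin n → Set
  Between x y w = dist x w ≡ dist x y + dist y w

  between? : ∀ x y w → Dec (Between x y w)
  between? x y w = dist x w ≟ℕ dist x y + dist y w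

  between-end : ∀ x y → Between x y y
  between-end x y = sym (trans (cong (dist x y +_) (dist-refl y)) (+-identityʳ _))

  between-step : ∀ {x y w z} → Between x y w → Adj G w z → dist x w < dist x z → Between x y z
  between-step {x} {y} {w} {z} y-between wz w<z = ≤-antisym (dist-triangle x y z) (begin
    dist x y + dist y z       ≤⟨ +-monoʳ-≤ (dist x y) (dist-step wz) ⟩
    dist x y + (dist y w + 1) ≡⟨ sym (+-assoc (dist x y) _ 1) ⟩
    dist x y + dist y w + 1   ≡⟨ cong (_+ 1) (sym y-between) ⟩
    dist x w + 1              ≡⟨ +-comm _ 1 ⟩
    suc (dist x w)            ≤⟨ w<z ⟩
    dist x z                  ∎)
    where open ≤-Reasoning

  ¬mutually-between : ∀ {x y w} → x ≢ y → Between x y w → Between y x w → ⊥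
  ¬mutually-between {x} {y} {w} x≢y xyw yxw = <-irrefl refl (begin-strict
    dist x w                         <⟨ m<n+m (dist x w) (dist-pos x≢y) ⟩
    dist x y + dist x w              ≤⟨ +-monoʳ-≤ (dist x y) (m≤n+m (dist x w) (dist y x)) ⟩
    dist x y + (dist y x + dist x w) ≡⟨ cong (dist x y +_) (sym yxw) ⟩
    dist x y + dist y w              ≡⟨ sym xyw ⟩
    dist x w                         ∎)
    where open ≤-Reasoning

module Tree {G : Graph n} (tree : IsTree G) where

  open GraphProperties G
  open Distance (proj₁ tree) public

  unique-parent : ∀ {x w z₁ z₂} → Adj G w z₁ → Adj G w z₂ →
    dist x z₁ ≤ dist x w → dist x z₂ ≤ dist x w → z₁ ≡ z₂
  -- A vertex of a geodesic from x other than its far end is strictly nearer to x, so the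
  -- geodesics z₁ → x → z₂ avoid w and close a cycle through w.
  unique-parent {x} {w} {z₁} {z₂} wz₁ wz₂ z₁≤w z₂≤w with z₁ ≟ z₂
  ... | yes z₁≡z₂ = z₁≡z₂
  ... | no z₁≢z₂  = ⊥-elim (proj₂ tree (avoiding-walk⇒HasCycle wz₁ (Adj-sym wz₂) z₁≢z₂ ω w∉ω))
    where
    ω : Walk G z₁ z₂ (dist z₁ x + dist x z₂)
    ω = geodesic z₁ x ++ʷ geodesic x z₂
    w∉ω : w ∉ˡ vertices ω
    w∉ω w∈ω with ∈-vertices-++⁻ (geodesic z₁ x) (geodesic x z₂) w∈ω
    ... | inj₁ w∈ = Adj⇒≢ wz₁ (far-from-end⇒start (geodesic z₁ x) w∈
                      (subst₂ _≤_ (dist-sym x z₁) (dist-sym x w) z₁≤w))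
    ... | inj₂ w∈ = Adj⇒≢ wz₂ (far-from-start⇒end (geodesic x z₂) w∈ z₂≤w)

  no-farther-neighbour⇒IsLeaf : ∀ {x w} → w ≢ x → (∀ {z} → Adj G w z → dist x z ≤ dist x w) →
    IsLeaf G w
  no-farther-neighbour⇒IsLeaf w≢x closer =
    let z , wz = neighbour-exists w≢x
    in unique-neighbour⇒IsLeaf wz (λ wz′ → unique-parent wz′ wz (closer wz′) (closer wz))

  geodesic-extends-to-leaf : ∀ {x y} → x ≢ y → ∃[ w ] IsLeaf G w × Between x y w
  geodesic-extends-to-leaf {x} {y} x≢y =
    extend (maximum-exists (between? x y) (dist x) (between-end x y))
    where
    extend : (∃[ w ] Between x y w × (∀ {v} → Between x y v → dist x v ≤ dist x w)) →
      ∃[ w ] IsLeaf G w × Between x y w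
    extend (w , y-between , farthest) = w , no-farther-neighbour⇒IsLeaf w≢x closer , y-between
      where
      w≢x : w ≢ x
      w≢x refl = <⇒≱ (≤-trans (dist-pos x≢y) (m≤m+n _ _))
                     (≤-reflexive (trans (sym y-between) (dist-refl x)))
      closer : ∀ {z} → Adj G w z → dist x z ≤ dist x w
      closer wz = ≮⇒≥ (λ w<z → <⇒≱ w<z (farthest (between-step y-between wz w<z)))

  strongly-resolved-by-leaf-other-than : ∀ u {x y} → x ≢ y →
    ∃[ w ] IsLeaf G w × w ≢ u × StronglyResolves G w x y
  strongly-resolved-by-leaf-other-than u {x} {y} x≢y =
    choose (geodesic-extends-to-leaf x≢y) (geodesic-extends-to-leaf (≢-sym x≢y))
    where
    choose : ∃[ w ] IsLeaf G w × Between x y w → ∃[ w ] IsLeaf G w × Between y x w →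
      ∃[ w ] IsLeaf G w × w ≢ u × StronglyResolves G w x y
    choose (w , leaf , xyw) (w′ , leaf′ , yxw′) with w ≟ u | w′ ≟ u
    ... | no w≢u   | _        = w , leaf , w≢u , strongly-resolves (inj₁ xyw)
    ... | yes _    | no w′≢u  =
      w′ , leaf′ , w′≢u , strongly-resolves (inj₂ (trans yxw′ (cong (_+ _) (dist-sym y x))))
    ... | yes refl | yes refl = ⊥-elim (¬mutually-between x≢y xyw yxw′)

  no-4-cycle : ∀ {x a y b} → x ≢ y → a ≢ b → Adj G x a → Adj G a y → Adj G y b → Adj G b x → ⊥
  no-4-cycle x≢y a≢b xa ay yb bx =
    proj₂ tree (_ , _ , _ , cons xa (cons ay (cons yb end)) ,
      (Adj⇒≢ xa All.∷ x≢y All.∷ ≢-sym (Adj⇒≢ bx) All.∷ All.[]) ∷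
      (Adj⇒≢ ay All.∷ a≢b All.∷ All.[]) ∷ (Adj⇒≢ yb All.∷ All.[]) ∷ All.[] ∷ [] ,
      s≤s (s≤s (s≤s z≤n)) , bx)

  private-neighbour-or-leaf : ∀ {x y} → x ≢ y → (∃[ a ] Adj G x a × E G y a ≡ false) ⊎ IsLeaf G x
  private-neighbour-or-leaf {x} {y} x≢y with neighbour-exists x≢y
  ... | a , xa with E G y a in ya
  ...   | false = inj₁ (a , xa , ya)
  ...   | true with any? (λ b → (E G x b ≟ᵇ true) ×-dec ¬? (b ≟ a))
  ...     | no ∄b = inj₂ (unique-neighbour⇒IsLeaf xa only-a)
    where
    only-a : ∀ {b} → Adj G x b → b ≡ a
    only-a {b} xb with b ≟ a
    ... | yes b≡a = b≡a
    ... | no b≢a  = ⊥-elim (∄b (b , xb , b≢a))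
  ...     | yes (b , xb , b≢a) with E G y b in yb
  ...       | false = inj₁ (b , xb , yb)
  ...       | true  = ⊥-elim (no-4-cycle x≢y (≢-sym b≢a) xa (Adj-sym ya) yb (Adj-sym xb))

module Complement {T : Graph n} where

  open GraphProperties T
  private
    module Tᶜ = GraphProperties (complement T)

  complement-Adj : ∀ {x y} → E T x y ≡ false → x ≢ y → Adj (complement T) x y
  complement-Adj {x} {y} xy≡false x≢y with x ≟ y
  ... | yes x≡y = ⊥-elim (x≢y x≡y)
  ... | no _ rewrite xy≡false = refl

  complement-Adj⁻ : ∀ {x y} → Adj (complement T) x y → E T x y ≡ false
  complement-Adj⁻ {x} {y} c-xy with E T x y
  ... | false = refl
  ... | true with () ← c-xy

  Dist-complement-nonAdj : ∀ {x y} → x ≢ y → E T x y ≡ false → Dist (complement T) x y 1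
  Dist-complement-nonAdj x≢y xy≡false =
    step (complement-Adj xy≡false x≢y) here ,
    λ { zero ω → ⊥-elim (x≢y (Tᶜ.Walk-length-0⇒≡ ω)) ; (suc _) _ → s≤s z≤n }

  module _ (diam≥4 : DiameterAtLeast T 4) where

    Dist-complement-Adj : ∀ {x y} → Adj T x y → Dist (complement T) x y 2
    Dist-complement-Adj {x} {y} xy with common-non-neighbour diam≥4 xy
    ... | z , z≢x , z≢y , xz , yz =
      step (complement-Adj xz (≢-sym z≢x))
           (step (complement-Adj (trans (E-sym T z y) yz) z≢y) here) ,
      minimal
      where
      minimal : ∀ m → Walk (complement T) x y m → 2 ≤ m
      minimal zero ω = ⊥-elim (Adj⇒≢ xy (Tᶜ.Walk-length-0⇒≡ ω))
      minimal (suc zero) (step c-xy here) with () ← trans (sym xy) (complement-Adj⁻ c-xy)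
      minimal (suc (suc _)) _ = s≤s (s≤s z≤n)

    complement-diameter≤2 : DiameterAtMost (complement T) 2
    complement-diameter≤2 x y with x ≟ y
    ... | yes refl = 0 , z≤n , Tᶜ.Dist-refl
    ... | no x≢y with E T x y in xy
    ...   | true  = 2 , ≤-refl , Dist-complement-Adj xy
    ...   | false = 1 , s≤s z≤n , Dist-complement-nonAdj x≢y xy

    complement-edge-resolved-only-by-ends : ∀ {w x y} → Adj T x y →
      StronglyResolves (complement T) w x y → w ≡ x ⊎ w ≡ y
    complement-edge-resolved-only-by-ends xy =
      Tᶜ.pair-at-distance-2-resolved-only-by-itself complement-diameter≤2 (Dist-complement-Adj xy)

    private-neighbour-resolves : ∀ {x y a} → x ≢ y → E T x y ≡ false → Adj T x a → E T y a ≡ false →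
      StronglyResolves (complement T) a x y
    private-neighbour-resolves {x} {y} {a} x≢y xy xa ya =
      2 , 1 , 1 , Dist-complement-Adj xa , Dist-complement-nonAdj x≢y xy ,
      Dist-complement-nonAdj y≢a ya , inj₁ refl
      where
      y≢a : y ≢ a
      y≢a refl with () ← trans (sym xy) xa

    complement-self-resolves : ∀ x y → StronglyResolves (complement T) x x y
    complement-self-resolves x y =
      let _ , _ , xy = complement-diameter≤2 x y in Tᶜ.self-strongly-resolves xy

module _ {T : Graph n} {S : Subset n} where

  open GraphProperties T

  generator-contains-all-leaves-but-one : IsStrongMetricGenerator T S → ∣ leaves T ∩ ∁ S ∣ ≤ 1
  generator-contains-all-leaves-but-one gen = ∣p∣≤1 (leaves T ∩ ∁ S) same
    where
    same : ∀ {x y} → x ∈ leaves T ∩ ∁ S → y ∈ leaves T ∩ ∁ S → x ≡ y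
    same {x} {y} x∈ y∈ with x∈p∩q⁻ (leaves T) (∁ S) x∈ | x∈p∩q⁻ (leaves T) (∁ S) y∈ | x ≟ y
    ... | _ | _ | yes x≡y = x≡y
    ... | x∈L , x∉S | y∈L , y∉S | no x≢y with gen x y x≢y
    ...   | w , w∈S , resolves
      with leaves-strongly-resolved-only-by-themselves
             (∈leaves⇒IsLeaf x∈L) (∈leaves⇒IsLeaf y∈L) x≢y resolves
    ...     | inj₁ refl = ⊥-elim (x∈∁p⇒x∉p x∉S w∈S)
    ...     | inj₂ refl = ⊥-elim (x∈∁p⇒x∉p y∉S w∈S)

  complement-generator-covers-edges : DiameterAtLeast T 4 →
    IsStrongMetricGenerator (complement T) S →
    IsVertexCoverInduced T (nonLeaves T) (S ∩ nonLeaves T)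
  complement-generator-covers-edges diam≥4 gen = p∩q⊆q S (nonLeaves T) , cover
    where
    open Complement
    cover : ∀ x y → x ∈ nonLeaves T → y ∈ nonLeaves T → Adj T x y →
      x ∈ S ∩ nonLeaves T ⊎ y ∈ S ∩ nonLeaves T
    cover x y x∈N y∈N xy with gen x y (Adj⇒≢ xy)
    ... | w , w∈S , resolves with complement-edge-resolved-only-by-ends diam≥4 xy resolves
    ...   | inj₁ refl = inj₁ (x∈p∩q⁺ (w∈S , x∈N))
    ...   | inj₂ refl = inj₂ (x∈p∩q⁺ (w∈S , y∈N))

  simultaneous-generator-lower-bound : ∀ {b} → DiameterAtLeast T 4 →
    IsStrongMetricGenerator T S → IsStrongMetricGenerator (complement T) S →
    VertexCoverNumberInduced T (nonLeaves T) b → b + numLeaves T ∸ 1 ≤ ∣ S ∣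
  simultaneous-generator-lower-bound {b} diam≥4 gen gen-c (_ , b-minimal) = begin
    b + ∣ L ∣ ∸ 1                   ≤⟨ ∸-monoˡ-≤ 1 (+-mono-≤ b≤ ∣L∣≤) ⟩
    ∣ S ∩ N ∣ + (∣ L ∩ S ∣ + 1) ∸ 1 ≡⟨ cong (_∸ 1) (sym (+-assoc ∣ S ∩ N ∣ _ 1)) ⟩
    ∣ S ∩ N ∣ + ∣ L ∩ S ∣ + 1 ∸ 1   ≡⟨ m+n∸n≡m _ 1 ⟩
    ∣ S ∩ N ∣ + ∣ L ∩ S ∣           ≤⟨ +-monoʳ-≤ ∣ S ∩ N ∣ (p⊆q⇒∣p∣≤∣q∣ L∩S⊆S∩∁N) ⟩
    ∣ S ∩ N ∣ + ∣ S ∩ ∁ N ∣         ≡⟨ sym (∣p∣≡∣p∩q∣+∣p∩∁q∣ S N) ⟩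
    ∣ S ∣                           ∎
    where
    open ≤-Reasoning
    L N : Subset n
    L = leaves T
    N = nonLeaves T
    b≤ : b ≤ ∣ S ∩ N ∣
    b≤ = b-minimal _ (complement-generator-covers-edges diam≥4 gen-c)
    ∣L∣≤ : ∣ L ∣ ≤ ∣ L ∩ S ∣ + 1
    ∣L∣≤ = begin
      ∣ L ∣                     ≡⟨ ∣p∣≡∣p∩q∣+∣p∩∁q∣ L S ⟩
      ∣ L ∩ S ∣ + ∣ L ∩ ∁ S ∣   ≤⟨ +-monoʳ-≤ ∣ L ∩ S ∣ (generator-contains-all-leaves-but-one gen) ⟩
      ∣ L ∩ S ∣ + 1             ∎
    L∩S⊆S∩∁N : L ∩ S ⊆ S ∩ ∁ N
    L∩S⊆S∩∁N x∈ with x∈p∩q⁻ L S x∈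
    ... | x∈L , x∈S = x∈p∩q⁺ (x∈S , x∉p⇒x∈∁p (λ x∈N →
                        x∈∁p⇒x∉p (subst (_ ∈_) (nonLeaves≡∁leaves T) x∈N) x∈L))

module UpperBound {T : Graph n} (tree : IsTree T) (diam≥4 : DiameterAtLeast T 4)
                  {u : Fin n} (u-leaf : IsLeaf T u)
                  {C : Subset n} (C-cover : IsVertexCoverInduced T (prunedExcept T u) C) where

  open GraphProperties T
  open Tree tree
  open Complement
  private
    module Tᶜ = GraphProperties (complement T)

  S : Subset n
  S = C ∪ (leaves T - u)

  ∣S∣≤ : ∣ S ∣ ≤ ∣ C ∣ + numLeaves T ∸ 1
  ∣S∣≤ = begin
    ∣ C ∪ (L - u) ∣     ≤⟨ ∣p∪q∣≤∣p∣+∣q∣ C (L - u) ⟩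
    ∣ C ∣ + ∣ L - u ∣   ≤⟨ +-monoʳ-≤ ∣ C ∣ (m+n≤o⇒m≤o∸n ∣ L - u ∣ ∣L-u∣+1≤∣L∣) ⟩
    ∣ C ∣ + (∣ L ∣ ∸ 1) ≡⟨ sym (+-∸-assoc ∣ C ∣ (m+n≤o⇒n≤o ∣ L - u ∣ ∣L-u∣+1≤∣L∣)) ⟩
    ∣ C ∣ + ∣ L ∣ ∸ 1   ∎
    where
    open ≤-Reasoning
    L : Subset n
    L = leaves T
    ∣L-u∣+1≤∣L∣ : ∣ L - u ∣ + 1 ≤ ∣ L ∣
    ∣L-u∣+1≤∣L∣ = subst (_≤ ∣ L ∣) (+-comm 1 _) (x∈p⇒∣p-x∣<∣p∣ (IsLeaf⇒∈leaves u-leaf))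

  leaf∈S : ∀ {w} → IsLeaf T w → w ≢ u → w ∈ S
  leaf∈S leaf w≢u = x∈p∪q⁺ (inj₂ (x∈p∧x≢y⇒x∈p-y (IsLeaf⇒∈leaves leaf) w≢u))

  ∉S-leaf⇒≡u : ∀ {v} → v ∉ S → IsLeaf T v → v ≡ u
  ∉S-leaf⇒≡u {v} v∉S leaf with v ≟ u
  ... | yes v≡u = v≡u
  ... | no v≢u  = ⊥-elim (v∉S (leaf∈S leaf v≢u))

  ∉S⇒∈prunedExcept : ∀ {v} → v ∉ S → v ∈ prunedExcept T u
  ∉S⇒∈prunedExcept {v} v∉S with v ∈? leaves T
  ... | yes v∈L =
    x∈p∪q⁺ (inj₂ (subst (_∈ ⁅ u ⁆) (sym (∉S-leaf⇒≡u v∉S (∈leaves⇒IsLeaf v∈L))) (x∈⁅x⁆ u)))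
  ... | no v∉L  = x∈p∪q⁺ (inj₁ (subst (v ∈_) (sym (nonLeaves≡∁leaves T)) (x∉p⇒x∈∁p v∉L)))

  ∉S⇒neighbours∈S : ∀ {v z} → v ∉ S → Adj T v z → z ∈ S
  ∉S⇒neighbours∈S {v} {z} v∉S vz with z ∈? S
  ... | yes z∈S = z∈S
  ... | no z∉S with proj₂ C-cover v z (∉S⇒∈prunedExcept v∉S) (∉S⇒∈prunedExcept z∉S) vz
  ...   | inj₁ v∈C = ⊥-elim (v∉S (x∈p∪q⁺ (inj₁ v∈C)))
  ...   | inj₂ z∈C = ⊥-elim (z∉S (x∈p∪q⁺ (inj₁ z∈C)))

  ∉S⇒non-adjacent : ∀ {x y} → x ∉ S → y ∉ S → E T x y ≡ false
  ∉S⇒non-adjacent {x} {y} x∉S y∉S with E T x y in xy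
  ... | false = refl
  ... | true  = ⊥-elim (y∉S (∉S⇒neighbours∈S x∉S xy))

  S-generates-T : IsStrongMetricGenerator T S
  S-generates-T x y x≢y =
    let w , leaf , w≢u , resolves = strongly-resolved-by-leaf-other-than u x≢y
    in w , leaf∈S leaf w≢u , resolves

  S-generates-complement : IsStrongMetricGenerator (complement T) S
  S-generates-complement x y x≢y with x ∈? S | y ∈? S
  ... | yes x∈S | _       = x , x∈S , complement-self-resolves diam≥4 x y
  ... | no _    | yes y∈S = y , y∈S , Tᶜ.StronglyResolves-sym (complement-self-resolves diam≥4 y x)
  ... | no x∉S  | no y∉S with private-neighbour-or-leaf x≢y | private-neighbour-or-leaf (≢-sym x≢y)
  ...   | inj₁ (a , xa , ya) | _ =
    a , ∉S⇒neighbours∈S x∉S xa ,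
    private-neighbour-resolves diam≥4 x≢y (∉S⇒non-adjacent x∉S y∉S) xa ya
  ...   | inj₂ _ | inj₁ (a , ya , xa) =
    a , ∉S⇒neighbours∈S y∉S ya ,
    Tᶜ.StronglyResolves-sym
      (private-neighbour-resolves diam≥4 (≢-sym x≢y) (∉S⇒non-adjacent y∉S x∉S) ya xa)
  ...   | inj₂ x-leaf | inj₂ y-leaf =
    ⊥-elim (x≢y (trans (∉S-leaf⇒≡u x∉S x-leaf) (sym (∉S-leaf⇒≡u y∉S y-leaf))))

mainTheorem11 : (n : ℕ) (T : Graph n) → IsTree T → DiameterAtLeast T 4 →
    (u : Fin n) → IsLeaf T u →
    (b₁ b₂ s : ℕ) →
    VertexCoverNumberInduced T (nonLeaves T) b₁ →
    VertexCoverNumberInduced T (prunedExcept T u) b₂ →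
    SimultaneousStrongMetricDim₂ T (complement T) s →
    (b₁ + numLeaves T ∸ 1 ≤ s) × (s ≤ b₂ + numLeaves T ∸ 1)
mainTheorem11 n T tree diam≥4 u u-leaf b₁ b₂ s
  β₁ ((C , C-cover , ∣C∣≡b₂) , _) ((S , (gen , gen-c) , ∣S∣≡s) , s-minimal) =
  subst (b₁ + numLeaves T ∸ 1 ≤_) ∣S∣≡s (simultaneous-generator-lower-bound diam≥4 gen gen-c β₁) ,
  (begin
    s                       ≤⟨ s-minimal U.S (U.S-generates-T , U.S-generates-complement) ⟩
    ∣ U.S ∣                 ≤⟨ U.∣S∣≤ ⟩
    ∣ C ∣ + numLeaves T ∸ 1 ≡⟨ cong (λ c → c + numLeaves T ∸ 1) ∣C∣≡b₂ ⟩
    b₂ + numLeaves T ∸ 1    ∎)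
  where
  open ≤-Reasoning
  module U = UpperBound tree diam≥4 u-leaf C-cover
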